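{- Let $(\mathcal C,X)$ be a pointed simplicial model with $\mathcal C=(C,\chi,\ell)$, and let $\mathfrak T_\varphi=((V,E),\lambda)$ be the formula life tree of a formula $\varphi\in\mathcal L^+$, with root $\rho$. Then $\mathcal C,X\not\bowtie\mathfrak T_\varphi$ if and only if at least one of the following holds: (1) $\lambda(\rho)\not\subseteq\chi(X)$; or (2) there are a subformula $\psi$ of $\varphi$, an agent $a$, and an edge $(\rho,\rho_\psi)\in E$ labeled $a$ whose endpoint $\rho_\psi$ is the root of a subtree of $\mathfrak T_\varphi$ equal to the $a$-grafting $\mathfrak T_\psi^a$, such that $\mathcal C,Y\not\bowtie\mathfrak T_\psi$ for every $Y\in\mathcal F(C)$ with $a\in\chi(X\cap Y)$.
   Context: Let $A$ be a finite set of agents and $P=A\sqcup\bigsqcup_{a\in A}P_a$, where the $P_a$ are countable, pairwise disjoint sets of local atoms (disjoint from $A$); each $a\in A$ is also a global atom. $\mathcal L^+$: $\varphi::=a\mid p_a\mid\neg\varphi\mid(\varphi\wedge\varphi)\mid\widehat K_a\varphi$. A simplicial model $\mathcal C=(C,\chi,\ell)$: $C$ a nonempty set of nonempty finite subsets (simplexes) of a vertex set $\mathcal V$, closed under nonempty subsets and containing all singletons; $\chi:\mathcal V\to A$ injective on each simplex; $\ell:\mathcal V\to 2^{P\setminus A}$ with $\ell(v)\subseteq P_{\chi(v)}$. $\chi(X)=\{\chi(v)\mid v\in X\}$. Facets are maximal simplexes, $\mathcal F(C)$ the set of facets; a pointed model is $(\mathcal C,X)$ with $X\in\mathcal F(C)$.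 A life tree $\mathfrak T=(\mathcal T,\lambda)$ is a directed rooted tree $\mathcal T=(V,E)$ with labels $\lambda(\sigma)\subseteq A$ on nodes and $\lambda(\sigma,\tau)\in A$ on edges satisfying $\lambda(\sigma,\tau)\in\lambda(\sigma)\cap\lambda(\tau)$. Its $a$-grafting $\mathfrak T^a$ adds $a$ to the root label. The formula life tree $\mathfrak T_\varphi$: $\mathfrak T_a$ is a single root labeled $\varnothing$; $\mathfrak T_{p_a}$ a single root labeled $\{a\}$; $\mathfrak T_{\neg\varphi}=\mathfrak T_\varphi$; $\mathfrak T_{\varphi\wedge\psi}$ is the disjoint union of $\mathfrak T_\varphi,\mathfrak T_\psi$ with roots merged into one root labeled by the union of the root labels; $\mathfrak T_{\widehat K_a\varphi}$ adds to $\mathfrak T_\varphi^a$ a new root labeled $\{a\}$ with an $a$-labeled edge to the root of $\mathfrak T_\varphi^a$. An embedding of a life tree $\mathfrak T=((V,E),\lambda)$ with root $\rho$ into $(\mathcal C,X)$ is a map $e:V\to\mathcal F(C)$ with $e(\rho)=X$, $\lambda(\sigma)\subseteq\chi(e(\sigma))$ for all $\sigma\in V$, and $\lambda(\sigma,\tau)\in\chi(e(\sigma)\cap e(\tau))$ for all $(\sigma,\tau)\in E$. $\mathcal C,X\bowtie\mathfrak T$ means such an embedding exists. -}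

module Defs where

open import Level using (0ℓ)
open import Data.Nat using (ℕ)
open import Data.Bool using (Bool)
open import Data.Fin using (Fin)
open import Data.Fin.Subset as S using (Subset; _∪_; ⁅_⁆; ⊥)
open import Data.List using (List; []; [_]; _∷_; _++_)
open import Data.List.Membership.Propositional using (_∈_)
open import Data.List.Relation.Binary.Subset.Propositional using (_⊆_)
open import Data.Product using (Σ; ∃; _×_; _,_)
open import Relation.Binary.PropositionalEquality using (_≡_; _≢_)

-- Agents are Fin n (a finite set A with |A| = n).
-- Local atoms of agent a: P_a is (indexed by) ℕ.

-- A simplex is a finite set of vertices, represented
-- by a list (only membership matters: all conditions below are stated
-- via membership, and C is required to be closed under nonempty subsets,
-- hence under "same elements").

record SimplicialModel (n : ℕ) : Set₁ where
  field
    𝒱  : Set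
    C  : List 𝒱 → Set
    χ  : 𝒱 → Fin n
    ℓ  : 𝒱 → ℕ → Bool                 -- ℓ(v) ⊆ P_{χ(v)} (k-th local atom of χ(v))
    C-inhabited : Σ (List 𝒱) C
    C-nonempty  : ∀ {X} → C X → X ≢ []
    C-down      : ∀ {X Y} → C X → Y ≢ [] → Y ⊆ X → C Y
    C-singleton : ∀ v → C [ v ]
    χ-inj       : ∀ {X} → C X → ∀ {u v} → u ∈ X → v ∈ X → χ u ≡ χ v → u ≡ v

module _ {n : ℕ} (M : SimplicialModel n) where
  open SimplicialModel M

  IsFacet : List 𝒱 → Set
  IsFacet X = C X × (∀ Y → C Y → X ⊆ Y → Y ⊆ X)

  _∈χ_ : Fin n → List 𝒱 → Set
  a ∈χ X = ∃ λ v → v ∈ X × χ v ≡ a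

  _∈χ∩_,_ : Fin n → List 𝒱 → List 𝒱 → Set
  a ∈χ∩ X , Y = ∃ λ v → v ∈ X × v ∈ Y × χ v ≡ a

  _⊆χ_ : Subset n → List 𝒱 → Set
  L ⊆χ X = ∀ a → a S.∈ L → a ∈χ X

data Form (n : ℕ) : Set where
  glob : Fin n → Form n
  loc  : Fin n → ℕ → Form n
  ¬'   : Form n → Form n
  _∧'_ : Form n → Form n → Form n
  K̂    : Fin n → Form n → Form n

data Sub {n : ℕ} : Form n → Form n → Set where
  refl : ∀ {φ} → Sub φ φ
  in¬  : ∀ {ψ φ} → Sub ψ φ → Sub ψ (¬' φ)
  in∧ˡ : ∀ {ψ φ χ} → Sub ψ φ → Sub ψ (φ ∧' χ)
  in∧ʳ : ∀ {ψ φ χ} → Sub ψ χ → Sub ψ (φ ∧' χ)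
  inK  : ∀ {ψ a φ} → Sub ψ φ → Sub ψ (K̂ a φ)

data LifeTree (n : ℕ) : Set where
  node : Subset n → List (Fin n × LifeTree n) → LifeTree n

rootLabel : ∀ {n} → LifeTree n → Subset n
rootLabel (node L _) = L

graft : ∀ {n} → Fin n → LifeTree n → LifeTree n
graft a (node L cs) = node (L ∪ ⁅ a ⁆) cs

merge : ∀ {n} → LifeTree n → LifeTree n → LifeTree n
merge (node L cs) (node M ds) = node (L ∪ M) (cs ++ ds)

𝔗 : ∀ {n} → Form n → LifeTree n
𝔗 (glob a)  = node ⊥ []
𝔗 (loc a k) = node ⁅ a ⁆ []
𝔗 (¬' φ)    = 𝔗 φ
𝔗 (φ ∧' ψ) = merge (𝔗 φ) (𝔗 ψ)
𝔗 (K̂ a φ)   = node ⁅ a ⁆ [ (a , graft a (𝔗 φ)) ]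

-- Nodes (vertices V) of a life tree, as paths from the root.
data Node {n : ℕ} : LifeTree n → Set where
  root : ∀ {t} → Node t
  down : ∀ {L cs a t} → (a , t) ∈ cs → Node t → Node (node L cs)

label : ∀ {n} {t : LifeTree n} → Node t → Subset n
label {t = t} root = rootLabel t
label (down _ σ)   = label σ

subtree : ∀ {n} {t : LifeTree n} → Node t → LifeTree n
subtree {t = t} root = t
subtree (down _ σ)   = subtree σ

data Edge {n : ℕ} : (t : LifeTree n) → Node t → Node t → Fin n → Set where
  top    : ∀ {L cs a t} (m : (a , t) ∈ cs) → Edge (node L cs) root (down m root) a
  deeper : ∀ {L cs b t σ τ a} (m : (b , t) ∈ cs) → Edge t σ τ a →
           Edge (node L cs) (down m σ) (down m τ) a

record Embedding {n : ℕ} (M : SimplicialModel n) (X : List (SimplicialModel.𝒱 M))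
                 (t : LifeTree n) : Set where
  open SimplicialModel M
  field
    e       : Node t → List 𝒱
    e-facet : ∀ σ → IsFacet M (e σ)
    e-root  : e root ≡ X
    e-label : ∀ σ → _⊆χ_ M (label σ) (e σ)
    e-edge  : ∀ σ τ a → Edge t σ τ a → _∈χ∩_,_ M a (e σ) (e τ)

_,_⋈_ : ∀ {n} (M : SimplicialModel n) → List (SimplicialModel.𝒱 M) → LifeTree n → Set
M , X ⋈ t = Embedding M X t

{-# OPTIONS --safe #-}
-- An embedding of a life tree at a facet X is the same as: the root label lies in χ(X), and
-- each child reached along an a-edge embeds at some facet sharing an a-coloured vertex with X.
-- The children of a formula life tree 𝔗 φ are the graftings 𝔗 ψ ^ a coming from subformulas
-- K̂ a ψ, and at a facet that already has an a-coloured vertex the grafting is irrelevant.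
-- Classically, the failure of this conjunction is the disjunction (1) ⊎ (2).
module Submission where

open import Defs
open import Level using (0ℓ)
open import Axiom.ExcludedMiddle using (ExcludedMiddle)
open import Data.Nat using (ℕ)
open import Data.Fin using (Fin)
open import Data.Fin.Subset using (_∪_; ⁅_⁆)
open import Data.Fin.Subset.Properties using (x∈p∪q⁻; p⊆p∪q; x∈⁅y⁆⇒x≡y)
open import Data.List using (List; _++_)
open import Data.List.Membership.Propositional using (_∈_)
open import Data.List.Membership.Propositional.Properties using (∈-++⁻)
open import Data.List.Relation.Unary.Any using (here)
open import Data.Product using (Σ; _×_; _,_)
open import Data.Sum using (_⊎_; inj₁; inj₂; [_,_]′)
open import Function using (_∘_)
open import Function.Bundles using (_⇔_; mk⇔; Equivalence)
open import Relation.Nullary using (¬_; yes; no; contradiction)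
open import Relation.Nullary.Decidable using (decidable-stable)
open import Relation.Binary.PropositionalEquality using (_≡_; refl; sym; subst)

children : ∀ {n} → LifeTree n → List (Fin n × LifeTree n)
children (node _ cs) = cs

child⇒root-edge : ∀ {n} {t : LifeTree n} {a s} → (a , s) ∈ children t →
                  Σ (Node t) λ τ → Edge t root τ a × subtree τ ≡ s
child⇒root-edge {t = node _ _} m = down m root , top m , refl

root-edge⇒child : ∀ {n} {t : LifeTree n} {τ a} → Edge t root τ a →
                  (a , subtree τ) ∈ children t
root-edge⇒child (top m) = m

children-merge : ∀ {n} (s t : LifeTree n) → children (merge s t) ≡ children s ++ children t
children-merge (node _ _) (node _ _) = refl

children-𝔗 : ∀ {n} (φ : Form n) {a s} → (a , s) ∈ children (𝔗 φ) →
             Σ (Form n) λ ψ → Sub ψ φ × s ≡ graft a (𝔗 ψ)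
children-𝔗 (¬' φ) m with children-𝔗 φ m
... | ψ , ψ⊑φ , s≡ = ψ , in¬ ψ⊑φ , s≡
children-𝔗 (φ ∧' φ′) m
  with ∈-++⁻ (children (𝔗 φ)) (subst (_ ∈_) (children-merge (𝔗 φ) (𝔗 φ′)) m)
... | inj₁ m′ = let ψ , ψ⊑φ , s≡ = children-𝔗 φ m′ in ψ , in∧ˡ ψ⊑φ , s≡
... | inj₂ m′ = let ψ , ψ⊑φ′ , s≡ = children-𝔗 φ′ m′ in ψ , in∧ʳ ψ⊑φ′ , s≡
children-𝔗 (K̂ a φ) (here refl) = φ , inK refl , refl

module _ {n : ℕ} (M : SimplicialModel n) where
  open SimplicialModel M
  open Embedding

  ∪-⊆χ : ∀ {L L′ X} → _⊆χ_ M L X → _⊆χ_ M L′ X → _⊆χ_ M (L ∪ L′) X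
  ∪-⊆χ {L} {L′} L⊆χX L′⊆χX b b∈ = [ L⊆χX b , L′⊆χX b ]′ (x∈p∪q⁻ L L′ b∈)

  ⁅⁆-⊆χ : ∀ {a X} → _∈χ_ M a X → _⊆χ_ M ⁅ a ⁆ X
  ⁅⁆-⊆χ {a} {X} a∈χX b b∈ =
    subst (λ c → _∈χ_ M c X) (sym (x∈⁅y⁆⇒x≡y a b∈)) a∈χX

  ∈χ∩⇒∈χʳ : ∀ {a X Y} → _∈χ∩_,_ M a X Y → _∈χ_ M a Y
  ∈χ∩⇒∈χʳ (v , _ , v∈Y , χv≡a) = v , v∈Y , χv≡a

  record _⟨_⟩⋈_ (X : List 𝒱) (a : Fin n) (t : LifeTree n) : Set where
    constructor adjacent
    field
      Y        : List 𝒱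
      Y-facet  : IsFacet M Y
      shares-a : _∈χ∩_,_ M a X Y
      Y⋈t      : M , Y ⋈ t

  ⋈-rootLabel : ∀ {X t} → M , X ⋈ t → _⊆χ_ M (rootLabel t) X
  ⋈-rootLabel E = subst (_⊆χ_ M _) (e-root E) (e-label E root)

  ⋈-children : ∀ {X t a s} → M , X ⋈ t → (a , s) ∈ children t → X ⟨ a ⟩⋈ s
  ⋈-children {X} {node L cs} {a} {s} E m =
    adjacent (e E (down m root)) (e-facet E (down m root)) X-shares-a restriction
    where
    X-shares-a : _∈χ∩_,_ M a X (e E (down m root))
    X-shares-a = subst (λ Z → _∈χ∩_,_ M a Z _) (e-root E) (e-edge E root (down m root) a (top m))

    restriction : M , e E (down m root) ⋈ s
    restriction = record
      { e       = e E ∘ down m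
      ; e-facet = e-facet E ∘ down m
      ; e-root  = refl
      ; e-label = e-label E ∘ down m
      ; e-edge  = λ σ τ b σ→τ → e-edge E (down m σ) (down m τ) b (deeper m σ→τ)
      }

  ⋈-node : ∀ {X t} → IsFacet M X → _⊆χ_ M (rootLabel t) X →
           (∀ {a s} → (a , s) ∈ children t → X ⟨ a ⟩⋈ s) → M , X ⋈ t
  ⋈-node {X} {node L cs} X-facet L⊆χX adj = record
    { e = e′ ; e-facet = e′-facet ; e-root = refl ; e-label = e′-label ; e-edge = e′-edge }
    where
    open _⟨_⟩⋈_
    e′ : Node (node L cs) → List 𝒱
    e′ root       = X
    e′ (down m σ) = e (Y⋈t (adj m)) σ
    e′-facet : ∀ σ → IsFacet M (e′ σ)
    e′-facet root       = X-facet
    e′-facet (down m σ) = e-facet (Y⋈t (adj m)) σ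
    e′-label : ∀ σ → _⊆χ_ M (label σ) (e′ σ)
    e′-label root       = L⊆χX
    e′-label (down m σ) = e-label (Y⋈t (adj m)) σ
    e′-edge : ∀ σ τ a → Edge (node L cs) σ τ a → _∈χ∩_,_ M a (e′ σ) (e′ τ)
    e′-edge _ _ a (top m)        =
      subst (_∈χ∩_,_ M a X) (sym (e-root (Y⋈t (adj m)))) (shares-a (adj m))
    e′-edge _ _ a (deeper m σ→τ) = e-edge (Y⋈t (adj m)) _ _ a σ→τ

  ⋈-ungraft : ∀ {Y a t} → IsFacet M Y → M , Y ⋈ graft a t → M , Y ⋈ t
  ⋈-ungraft {a = a} {t = node L _} Y-facet E =
    ⋈-node Y-facet (λ b → ⋈-rootLabel E b ∘ p⊆p∪q ⁅ a ⁆) (⋈-children E)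

  ⋈-graft : ∀ {Y a t} → IsFacet M Y → _∈χ_ M a Y → M , Y ⋈ t → M , Y ⋈ graft a t
  ⋈-graft {t = node _ _} Y-facet a∈χY E =
    ⋈-node Y-facet (∪-⊆χ (⋈-rootLabel E) (⁅⁆-⊆χ a∈χY)) (⋈-children E)

  ⟨⟩⋈-graft⇔ : ∀ {X a t} → X ⟨ a ⟩⋈ graft a t ⇔ X ⟨ a ⟩⋈ t
  ⟨⟩⋈-graft⇔ = mk⇔
    (λ (adjacent Y Y-facet shares-a E) →
       adjacent Y Y-facet shares-a (⋈-ungraft Y-facet E))
    (λ (adjacent Y Y-facet shares-a E) →
       adjacent Y Y-facet shares-a (⋈-graft Y-facet (∈χ∩⇒∈χʳ shares-a) E))

  UnembeddableChild : List 𝒱 → Form n → Set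
  UnembeddableChild X φ =
    Σ (Form n) λ ψ → Sub ψ φ × Σ (Fin n) λ a → Σ (Node (𝔗 φ)) λ ρψ →
      Edge (𝔗 φ) root ρψ a × subtree ρψ ≡ graft a (𝔗 ψ)
      × (∀ Y → IsFacet M Y → _∈χ∩_,_ M a X Y → ¬ (M , Y ⋈ 𝔗 ψ))

  Obstruction : List 𝒱 → Form n → Set
  Obstruction X φ = ¬ (_⊆χ_ M (rootLabel (𝔗 φ)) X) ⊎ UnembeddableChild X φ

  obstruction⇒¬⋈ : ∀ {X φ} → Obstruction X φ → ¬ (M , X ⋈ 𝔗 φ)
  obstruction⇒¬⋈ (inj₁ ¬root) E = ¬root (⋈-rootLabel E)
  obstruction⇒¬⋈ {X} (inj₂ (ψ , _ , a , ρψ , root→ρψ , ρψ-grafted , none)) E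
    with adjacent Y Y-facet shares-a Y⋈𝔗ψ ← Equivalence.to ⟨⟩⋈-graft⇔
           (subst (X ⟨ a ⟩⋈_) ρψ-grafted (⋈-children E (root-edge⇒child root→ρψ)))
    = none Y Y-facet shares-a Y⋈𝔗ψ

  ⋈-without-unembeddable-child : ExcludedMiddle 0ℓ → ∀ {X φ} → IsFacet M X →
    _⊆χ_ M (rootLabel (𝔗 φ)) X → ¬ UnembeddableChild X φ → M , X ⋈ 𝔗 φ
  ⋈-without-unembeddable-child lem {X} {φ} X-facet root-ok no-bad =
    ⋈-node X-facet root-ok adjacent-child
    where
    adjacent-child : ∀ {a s} → (a , s) ∈ children (𝔗 φ) → X ⟨ a ⟩⋈ s
    adjacent-child {a} m with children-𝔗 φ m | child⇒root-edge m
    ... | ψ , ψ⊑φ , refl | ρψ , root→ρψ , ρψ-grafted =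
      Equivalence.from ⟨⟩⋈-graft⇔ (decidable-stable lem λ ¬adj →
        no-bad (ψ , ψ⊑φ , a , ρψ , root→ρψ , ρψ-grafted ,
                λ Y Y-facet shares-a Y⋈𝔗ψ → ¬adj (adjacent Y Y-facet shares-a Y⋈𝔗ψ)))

  ¬⋈⇒obstruction : ExcludedMiddle 0ℓ → ∀ {X φ} → IsFacet M X →
                   ¬ (M , X ⋈ 𝔗 φ) → Obstruction X φ
  ¬⋈⇒obstruction lem {X} {φ} X-facet ¬E
    with lem {_⊆χ_ M (rootLabel (𝔗 φ)) X} | lem {UnembeddableChild X φ}
  ... | no ¬root    | _       = inj₁ ¬root
  ... | yes _       | yes bad = inj₂ bad
  ... | yes root-ok | no ¬bad =
    contradiction (⋈-without-unembeddable-child lem X-facet root-ok ¬bad) ¬E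

lemma4p10 : ExcludedMiddle 0ℓ →
    ∀ {n : ℕ} (M : SimplicialModel n) (X : List (SimplicialModel.𝒱 M)) → IsFacet M X →
    (φ : Form n) →
    (¬ (M , X ⋈ 𝔗 φ))
      ⇔ ((¬ (_⊆χ_ M (label {t = 𝔗 φ} root) X))
         ⊎ (Σ (Form n) λ ψ → Sub ψ φ × Σ (Fin n) λ a → Σ (Node (𝔗 φ)) λ ρψ →
              Edge (𝔗 φ) root ρψ a × subtree ρψ ≡ graft a (𝔗 ψ)
              × (∀ Y → IsFacet M Y → _∈χ∩_,_ M a X Y → ¬ (M , Y ⋈ 𝔗 ψ))))
lemma4p10 lem M X X-facet φ = mk⇔ (¬⋈⇒obstruction M lem X-facet) (obstruction⇒¬⋈ M)
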